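{- Let $P=([n],\preceq)$ be a poset and $0\le r\le n$. Suppose there exist two different ideals $I',I''\in\mathcal{I}_P^r$ such that $P^r=I'\cup I''$. Then no $r$-perfect $P$-codes exist.
   Context: $[n]=\{1,\dots,n\}$; subsets of $[n]$ are identified with their characteristic vectors in $F^n=\{0,1\}^n$, and $x+y$ is the symmetric difference. An ideal of $P$ is a set $I\subseteq[n]$ such that $a\in I$ and $b\preceq a$ imply $b\in I$; ${<}X{>}$ is the smallest ideal containing $X$. $\mathcal{I}_P^r$ is the set of ideals of cardinality $r$ and $P^r=\bigcup_{J\in\mathcal{I}_P^r}J$. The $P$-weight is $w_P(x)=|{<}x{>}|$ and $\mathcal{B}_P^r=\{x\in F^n: w_P(x)\le r\}$. A $P$-code $\mathcal{C}\subseteq F^n$ is $r$-perfect if every $x\in F^n$ has exactly one representation $x=c+b$ with $c\in\mathcal{C}$, $b\in\mathcal{B}_P^r$. -}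

module Defs where

open import Level using (0ℓ)
open import Data.Nat using (ℕ; _≤_)
open import Data.Bool using (Bool; true; false; _xor_; _∧_)
open import Data.Fin using (Fin)
open import Data.Fin.Subset using (Subset; _∈_; ∣_∣; _∪_)
open import Data.Vec using (tabulate; zipWith; lookup)
open import Data.Product using (Σ; ∃; _×_; _,_)
open import Relation.Binary using (Rel; IsDecPartialOrder)
open import Relation.Binary.PropositionalEquality using (_≡_)
open import Relation.Nullary.Decidable using (⌊_⌋)
open import Data.Fin.Properties using (any?)

record Poset (n : ℕ) : Set₁ where
  field
    _≼_ : Rel (Fin n) 0ℓ
    isDecPartialOrder : IsDecPartialOrder _≡_ _≼_
  open IsDecPartialOrder isDecPartialOrder public using (_≤?_)

module _ {n : ℕ} (P : Poset n) where
  open Poset P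

  IsIdeal : Subset n → Set
  IsIdeal I = ∀ a b → a ∈ I → b ≼ a → b ∈ I

  IsIdealOfSize : ℕ → Subset n → Set
  IsIdealOfSize r I = IsIdeal I × ∣ I ∣ ≡ r

  InPr : ℕ → Fin n → Set
  InPr r a = ∃ λ J → IsIdealOfSize r J × a ∈ J

  -- ⟨x⟩ : the smallest ideal containing x, i.e. {b | ∃ a ∈ x, b ≼ a}
  ⟨_⟩ : Subset n → Subset n
  ⟨ x ⟩ = tabulate (λ b → ⌊ any? (λ a → (lookup x a ≡? true) ×? (b ≤? a)) ⌋)
    where
    open import Relation.Nullary.Decidable using (_×-dec_)
    open import Data.Bool.Properties using (_≟_)
    _≡?_ = _≟_
    _×?_ = _×-dec_
    infix 5 _≡?_

  wP : Subset n → ℕ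
  wP x = ∣ ⟨ x ⟩ ∣

  InBall : ℕ → Subset n → Set
  InBall r x = wP x ≤ r

  -- a code is a subset of F^n = {0,1}^n, given as a predicate;
  -- r-perfect: every x has exactly one representation x = c + b, c ∈ C, b ∈ 𝓑_P^r
  IsPerfect : ℕ → (Subset n → Set) → Set
  IsPerfect r C = ∀ x →
      (∃ λ c → ∃ λ b → C c × InBall r b × x ≡ c + b)
    × (∀ c b c′ b′ → C c → InBall r b → x ≡ c + b
                   → C c′ → InBall r b′ → x ≡ c′ + b′ → (c ≡ c′ × b ≡ b′))
    where
    _+_ : Subset n → Subset n → Subset n
    _+_ = zipWith _xor_

-- For b of P-weight at most r the ideal ⟨b⟩ extends to an ideal of size r, so the ball 𝓑_P^r
-- consists of subsets of S = P^r = I′ ∪ I″; and every subset of S is the sum of a subset of I′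
-- and a subset of I″, i.e. of two vectors of the ball. Take a codeword c₀ and write c₀ + S = c + b.
-- Then c₀ + c = S + b ⊆ S is a sum of two ball vectors, which perfectness allows only for c = c₀;
-- hence b = S and |S| ≤ w_P(S) ≤ r. But two distinct ideals of size r have a union of size > r.
module Submission where

open import Defs
import Data.Nat as ℕ
open import Data.Nat using (ℕ; _≤_; _<_; _∸_; zero; suc)
open import Data.Nat.Properties
  using (module ≤-Reasoning; ≤-reflexive; ≤-trans; ≤-pred; n≤0⇒n≡0; n≤1+n; <⇒≱; <⇒≢; ≤∧≢⇒<; m<n⇒0<n∸m)
open import Data.Bool using (true; false; _xor_)
open import Data.Bool.Properties using (xor-assoc; xor-comm; xor-same; xor-identityˡ; T-≡)
open import Data.Fin using (Fin; zero; suc)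
open import Data.Fin.Subset using (Subset; _∈_; _∉_; _⊆_; _∪_; _∩_; ∁; ⁅_⁆; ⊥; ∣_∣)
open import Data.Fin.Subset.Properties
  using ( _∈?_; ⊆-refl; ⊆-antisym; ∣⊥∣≡0; ∣∁p∣≡n∸∣p∣; Empty-unique; nonempty?; x∈∁p⇒x∉p
        ; p⊆q⇒∣p∣≤∣q∣; p⊂q⇒∣p∣<∣q∣; p⊆p∪q; q⊆p∪q; x∈p∪q⁻; x∈p∪q⁺; p∩q⊆q; x∈p∩q⁻
        ; x∈⁅x⁆; x∈⁅y⁆⇒x≡y; ∪-identityʳ)
open import Data.Fin.Properties using (any?)
open import Data.Fin.Induction using (po-wellFounded)
open import Data.Vec using ([]; _∷_; zipWith; here; there)
open import Data.Vec.Properties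
  using (zipWith-assoc; zipWith-comm; zipWith-identityˡ; []=⇒lookup; lookup⇒[]=; lookup∘tabulate)
open import Data.Product using (∃; ∃₂; _×_; _,_; proj₁; proj₂)
open import Data.Sum using (inj₁; inj₂)
open import Function using (_∘_)
open import Function.Bundles using (_⇔_; Equivalence)
open import Induction.WellFounded using (WellFounded; Acc; acc)
open import Level using (0ℓ)
open import Relation.Binary using (Rel; Decidable; IsDecPartialOrder)
open import Relation.Binary.PropositionalEquality
  using (_≡_; _≢_; refl; sym; trans; cong; cong₂; subst; module ≡-Reasoning)
import Relation.Binary.Construct.NonStrictToStrict as ToStrict
open import Relation.Nullary using (¬_; yes; no; contradiction)
open import Relation.Nullary.Decidable using (toWitness; fromWitness; _×-dec_; ¬?; decidable-stable)
open import Relation.Unary using (Pred)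
import Relation.Unary as U

private variable
  n : ℕ
  p q r s : Subset n

infixl 6 _⊕_

_⊕_ : Subset n → Subset n → Subset n
_⊕_ = zipWith _xor_

⊕-assoc : ∀ (p q r : Subset n) → (p ⊕ q) ⊕ r ≡ p ⊕ (q ⊕ r)
⊕-assoc = zipWith-assoc xor-assoc

⊕-comm : ∀ (p q : Subset n) → p ⊕ q ≡ q ⊕ p
⊕-comm = zipWith-comm xor-comm

⊕-self : ∀ (p : Subset n) → p ⊕ p ≡ ⊥
⊕-self [] = refl
⊕-self (x ∷ p) = cong₂ _∷_ (xor-same x) (⊕-self p)

p⊕[p⊕q]≡q : ∀ (p q : Subset n) → p ⊕ (p ⊕ q) ≡ q
p⊕[p⊕q]≡q p q = begin
  p ⊕ (p ⊕ q)  ≡⟨ sym (⊕-assoc p p q) ⟩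
  (p ⊕ p) ⊕ q  ≡⟨ cong (_⊕ q) (⊕-self p) ⟩
  ⊥ ⊕ q        ≡⟨ zipWith-identityˡ xor-identityˡ q ⟩
  q            ∎
  where open ≡-Reasoning

⊕-moveˡ : p ⊕ q ≡ r → q ≡ p ⊕ r
⊕-moveˡ {p = p} {q} refl = sym (p⊕[p⊕q]≡q p q)

⊕-cancelˡ : p ⊕ q ≡ p ⊕ r → q ≡ r
⊕-cancelˡ {p = p} {r = r} eq = trans (⊕-moveˡ eq) (p⊕[p⊕q]≡q p r)

⊕-swap : p ⊕ q ≡ r ⊕ s → p ⊕ r ≡ q ⊕ s
⊕-swap {p = p} {q} {r} {s} eq = trans (⊕-moveˡ (sym q≡s⊕[p⊕r])) (⊕-comm s q)
  where
  open ≡-Reasoning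
  q≡s⊕[p⊕r] : q ≡ s ⊕ (p ⊕ r)
  q≡s⊕[p⊕r] = begin
    q            ≡⟨ ⊕-moveˡ eq ⟩
    p ⊕ (r ⊕ s)  ≡⟨ sym (⊕-assoc p r s) ⟩
    (p ⊕ r) ⊕ s  ≡⟨ ⊕-comm (p ⊕ r) s ⟩
    s ⊕ (p ⊕ r)  ∎

⊕⊆∪ : ∀ (p q : Subset n) → p ⊕ q ⊆ p ∪ q
⊕⊆∪ (true  ∷ p) (false ∷ q) here      = here
⊕⊆∪ (false ∷ p) (true  ∷ q) here      = here
⊕⊆∪ (_     ∷ p) (_     ∷ q) (there x) = there (⊕⊆∪ p q x)

⊕-split : ∀ (d p : Subset n) → d ≡ (d ∩ p) ⊕ (d ∩ ∁ p)
⊕-split []          []          = refl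
⊕-split (false ∷ d) (_     ∷ p) = cong (false ∷_) (⊕-split d p)
⊕-split (true  ∷ d) (true  ∷ p) = cong (true ∷_) (⊕-split d p)
⊕-split (true  ∷ d) (false ∷ p) = cong (true ∷_) (⊕-split d p)

⊆∪⇒⊕-split : p ⊆ q ∪ r → ∃₂ λ b₁ b₂ → b₁ ⊆ q × b₂ ⊆ r × p ≡ b₁ ⊕ b₂
⊆∪⇒⊕-split {p = p} {q} {r} p⊆q∪r = p ∩ q , p ∩ ∁ q , p∩q⊆q p q , p∩∁q⊆r , ⊕-split p q
  where
  p∩∁q⊆r : p ∩ ∁ q ⊆ r
  p∩∁q⊆r x∈ with x∈p∩q⁻ p (∁ q) x∈
  ... | x∈p , x∈∁q with x∈p∪q⁻ q r (p⊆q∪r x∈p)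
  ...   | inj₁ x∈q = contradiction x∈q (x∈∁p⇒x∉p x∈∁q)
  ...   | inj₂ x∈r = x∈r

⊆∧⊆⇒⊕⊆ : p ⊆ r → q ⊆ r → p ⊕ q ⊆ r
⊆∧⊆⇒⊕⊆ {p = p} {r} {q} p⊆r q⊆r x∈ with x∈p∪q⁻ p q (⊕⊆∪ p q x∈)
... | inj₁ x∈p = p⊆r x∈p
... | inj₂ x∈q = q⊆r x∈q

⊆∧∣∣≤⇒≡ : p ⊆ q → ∣ q ∣ ≤ ∣ p ∣ → p ≡ q
⊆∧∣∣≤⇒≡ {p = p} {q} p⊆q ∣q∣≤∣p∣ = ⊆-antisym p⊆q q⊆p
  where
  q⊆p : q ⊆ p
  q⊆p {x} x∈q with x ∈? p
  ... | yes x∈p = x∈p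
  ... | no  x∉p = contradiction ∣q∣≤∣p∣ (<⇒≱ (p⊂q⇒∣p∣<∣q∣ (p⊆q , x , x∈q , x∉p)))

≢∧∣∣≡⇒<∣∪∣ : ∀ {m} → ∣ p ∣ ≡ m → ∣ q ∣ ≡ m → p ≢ q → m < ∣ p ∪ q ∣
≢∧∣∣≡⇒<∣∪∣ {p = p} {q} refl ∣q∣≡∣p∣ p≢q = ≤∧≢⇒< (p⊆q⇒∣p∣≤∣q∣ (p⊆p∪q {p = p} q)) ∣p∣≢∣p∪q∣
  where
  ∣p∣≢∣p∪q∣ : ∣ p ∣ ≢ ∣ p ∪ q ∣
  ∣p∣≢∣p∪q∣ eq = p≢q (sym (⊆∧∣∣≤⇒≡ q⊆p (≤-reflexive (sym ∣q∣≡∣p∣))))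
    where
    p≡p∪q : p ≡ p ∪ q
    p≡p∪q = ⊆∧∣∣≤⇒≡ (p⊆p∪q q) (≤-reflexive (sym eq))
    q⊆p : q ⊆ p
    q⊆p x∈q = subst (_ ∈_) (sym p≡p∪q) (q⊆p∪q p q x∈q)

∣p∣<n⇒∃∉ : ∀ {n} {p : Subset n} → ∣ p ∣ < n → ∃ λ x → x ∉ p
∣p∣<n⇒∃∉ {n} {p} ∣p∣<n with nonempty? (∁ p)
... | yes (x , x∈∁p) = x , x∈∁p⇒x∉p x∈∁p
... | no ∁p-empty = contradiction 0≡n∸∣p∣ (<⇒≢ (m<n⇒0<n∸m ∣p∣<n))
  where
  0≡n∸∣p∣ : 0 ≡ n ∸ ∣ p ∣
  0≡n∸∣p∣ = trans (sym (trans (cong ∣_∣ (Empty-unique ∁p-empty)) (∣⊥∣≡0 n))) (∣∁p∣≡n∸∣p∣ p)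

∣p∪⁅x⁆∣≡1+∣p∣ : ∀ (p : Subset n) x → x ∉ p → ∣ p ∪ ⁅ x ⁆ ∣ ≡ suc ∣ p ∣
∣p∪⁅x⁆∣≡1+∣p∣ (true  ∷ p) zero    x∉p = contradiction here x∉p
∣p∪⁅x⁆∣≡1+∣p∣ (false ∷ p) zero    _   = cong (suc ∘ ∣_∣) (∪-identityʳ p)
∣p∪⁅x⁆∣≡1+∣p∣ (true  ∷ p) (suc x) x∉p = cong suc (∣p∪⁅x⁆∣≡1+∣p∣ p x (x∉p ∘ there))
∣p∪⁅x⁆∣≡1+∣p∣ (false ∷ p) (suc x) x∉p = ∣p∪⁅x⁆∣≡1+∣p∣ p x (x∉p ∘ there)

module _ {ℓ ℓ′} {_<_ : Rel (Fin n) ℓ} (<-wf : WellFounded _<_) (_<?_ : Decidable _<_)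
         {Q : Pred (Fin n) ℓ′} (Q? : U.Decidable Q) where

  ∃-minimal : ∀ {x} → Q x → ∃ λ m → Q m × ∀ {y} → y < m → ¬ Q y
  ∃-minimal {x} = go x (<-wf x)
    where
    go : ∀ x → Acc _<_ x → Q x → ∃ λ m → Q m × ∀ {y} → y < m → ¬ Q y
    go x (acc rs) Qx with any? (λ y → (y <? x) ×-dec Q? y)
    ... | yes (y , y<x , Qy) = go y (rs y<x) Qy
    ... | no  none           = x , Qx , λ y<x Qy → none (_ , y<x , Qy)

module _ {n : ℕ} (P : Poset n) where
  open Poset P
  open IsDecPartialOrder isDecPartialOrder using (isPartialOrder; _≟_)
    renaming (refl to ≼-refl; trans to ≼-trans)

  _≺_ : Rel (Fin n) 0ℓ
  _≺_ = ToStrict._<_ _≡_ _≼_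

  ∈⟨⟩⁻ : ∀ x {b} → b ∈ ⟨_⟩ P x → ∃ λ a → a ∈ x × b ≼ a
  ∈⟨⟩⁻ x {b} b∈ with toWitness (Equivalence.from T-≡ (trans (sym (lookup∘tabulate _ b)) ([]=⇒lookup b∈)))
  ... | a , xa≡true , b≼a = a , lookup⇒[]= a x xa≡true , b≼a

  ∈⟨⟩⁺ : ∀ {x a b} → a ∈ x → b ≼ a → b ∈ ⟨_⟩ P x
  ∈⟨⟩⁺ {x} {a} {b} a∈x b≼a =
    lookup⇒[]= b _ (trans (lookup∘tabulate _ b) (Equivalence.to T-≡ (fromWitness (a , []=⇒lookup a∈x , b≼a))))

  ⟨⟩-isIdeal : ∀ x → IsIdeal P (⟨_⟩ P x)
  ⟨⟩-isIdeal x a b a∈ b≼a with ∈⟨⟩⁻ x a∈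
  ... | c , c∈x , a≼c = ∈⟨⟩⁺ c∈x (≼-trans b≼a a≼c)

  ⊆⟨⟩ : ∀ x → x ⊆ ⟨_⟩ P x
  ⊆⟨⟩ x a∈x = ∈⟨⟩⁺ a∈x ≼-refl

  ⟨⟩-least : ∀ {x I} → IsIdeal P I → x ⊆ I → ⟨_⟩ P x ⊆ I
  ⟨⟩-least {x} I-ideal x⊆I b∈ with ∈⟨⟩⁻ x b∈
  ... | a , a∈x , b≼a = I-ideal a _ (x⊆I a∈x) b≼a

  ∣x∣≤wP : ∀ x → ∣ x ∣ ≤ wP P x
  ∣x∣≤wP x = p⊆q⇒∣p∣≤∣q∣ (⊆⟨⟩ x)

  ⊆idealOfSize⇒inBall : ∀ {r x I} → IsIdealOfSize P r I → x ⊆ I → InBall P r x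
  ⊆idealOfSize⇒inBall (I-ideal , refl) x⊆I = p⊆q⇒∣p∣≤∣q∣ (⟨⟩-least I-ideal x⊆I)

  ideal-∪-minimal : ∀ {J m} → IsIdeal P J → (∀ {b} → b ≺ m → b ∈ J) → IsIdeal P (J ∪ ⁅ m ⁆)
  ideal-∪-minimal {J} {m} J-ideal below-m a b a∈ b≼a with x∈p∪q⁻ J ⁅ m ⁆ a∈
  ... | inj₁ a∈J = x∈p∪q⁺ (inj₁ (J-ideal a b a∈J b≼a))
  ... | inj₂ a∈m with x∈⁅y⁆⇒x≡y m a∈m | b ≟ m
  ...   | refl | yes refl = x∈p∪q⁺ (inj₂ (x∈⁅x⁆ b))
  ...   | refl | no  b≢m  = x∈p∪q⁺ (inj₁ (below-m (b≼a , b≢m)))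

  ideal-grows : ∀ {m K} → IsIdealOfSize P m K → m < n →
                ∃ λ K′ → IsIdealOfSize P (suc m) K′ × K ⊆ K′
  ideal-grows {m} {K} (K-ideal , refl) m<n
    with ∃-minimal (po-wellFounded isPartialOrder) (ToStrict.<-decidable _≡_ _≼_ _≟_ _≤?_)
                   (λ x → ¬? (x ∈? K)) (proj₂ (∣p∣<n⇒∃∉ m<n))
  ... | x , x∉K , minimal =
    K ∪ ⁅ x ⁆ ,
    (ideal-∪-minimal K-ideal (λ b≺x → decidable-stable (_ ∈? K) (minimal b≺x)) ,
     ∣p∪⁅x⁆∣≡1+∣p∣ K x x∉K) ,
    p⊆p∪q ⁅ x ⁆

  ideal-extends : ∀ {J} m → IsIdeal P J → ∣ J ∣ ≤ m → m ≤ n → ∃ λ K → IsIdealOfSize P m K × J ⊆ K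
  ideal-extends {J} m J-ideal ∣J∣≤m m≤n with ∣ J ∣ ℕ.≟ m
  ... | yes ∣J∣≡m = J , (J-ideal , ∣J∣≡m) , ⊆-refl
  ideal-extends zero    J-ideal ∣J∣≤0   _     | no ∣J∣≢0 = contradiction (n≤0⇒n≡0 ∣J∣≤0) ∣J∣≢0
  ideal-extends (suc m) J-ideal ∣J∣≤1+m 1+m≤n | no ∣J∣≢1+m
    with ideal-extends m J-ideal (≤-pred (≤∧≢⇒< ∣J∣≤1+m ∣J∣≢1+m)) (≤-trans (n≤1+n m) 1+m≤n)
  ... | K , K-ideal , J⊆K with ideal-grows K-ideal 1+m≤n
  ...   | K′ , K′-ideal , K⊆K′ = K′ , K′-ideal , K⊆K′ ∘ J⊆K

  inBall⊆Pr : ∀ {r x} → r ≤ n → InBall P r x → ∀ {a} → a ∈ x → InPr P r a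
  inBall⊆Pr {r} {x} r≤n x∈Ball a∈x with ideal-extends r (⟨⟩-isIdeal x) x∈Ball r≤n
  ... | K , K-ideal , ⟨x⟩⊆K = K , K-ideal , ⟨x⟩⊆K (⊆⟨⟩ x a∈x)

  module _ {r : ℕ} {C : Subset n → Set} (perfect : IsPerfect P r C) where

    perfect⇒∃codeword : ∃ C
    perfect⇒∃codeword with proj₁ (perfect ⊥)
    ... | c , _ , c∈C , _ = c , c∈C

    perfect⇒codewords-separated : ∀ {c c′ b b′} → C c → C c′ → InBall P r b → InBall P r b′ →
                                  c ⊕ c′ ≡ b ⊕ b′ → c ≡ c′
    perfect⇒codewords-separated {c} {c′} {b} {b′} c∈C c′∈C b∈Ball b′∈Ball eq =
      proj₁ (proj₂ (perfect (c ⊕ b)) c b c′ b′ c∈C b∈Ball refl c′∈C b′∈Ball (⊕-swap eq))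

    perfect⇒cover∈Ball : ∀ {I′ I″ S} → IsIdealOfSize P r I′ → IsIdealOfSize P r I″ → S ⊆ I′ ∪ I″ →
                        (∀ {b} → InBall P r b → b ⊆ S) → InBall P r S
    perfect⇒cover∈Ball {S = S} I′-ideal I″-ideal S⊆I′∪I″ ball⊆S with perfect⇒∃codeword
    ... | c₀ , c₀∈C with proj₁ (perfect (c₀ ⊕ S))
    ... | c , β , c∈C , β∈Ball , c₀⊕S≡c⊕β with ⊆∪⇒⊕-split (S⊆I′∪I″ ∘ ⊆∧⊆⇒⊕⊆ ⊆-refl (ball⊆S β∈Ball))
    ... | b′ , b″ , b′⊆I′ , b″⊆I″ , S⊕β≡b′⊕b″ = subst (InBall P r) (sym S≡β) β∈Ball
      where
      c₀≡c : c₀ ≡ c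
      c₀≡c = perfect⇒codewords-separated c₀∈C c∈C
        (⊆idealOfSize⇒inBall I′-ideal b′⊆I′) (⊆idealOfSize⇒inBall I″-ideal b″⊆I″)
        (trans (⊕-swap c₀⊕S≡c⊕β) S⊕β≡b′⊕b″)
      S≡β : S ≡ β
      S≡β = ⊕-cancelˡ (subst (λ c → c₀ ⊕ S ≡ c ⊕ β) (sym c₀≡c) c₀⊕S≡c⊕β)

corollary4 : (n : ℕ) (P : Poset n) (r : ℕ) → r ≤ n →
    (I′ I″ : Subset n) → IsIdealOfSize P r I′ → IsIdealOfSize P r I″ → ¬ (I′ ≡ I″) →
    (∀ (a : Fin n) → InPr P r a ⇔ (a ∈ I′ ∪ I″)) →
    (C : Subset n → Set) → ¬ IsPerfect P r C
corollary4 n P r r≤n I′ I″ I′-ideal I″-ideal I′≢I″ Pr⇔I′∪I″ C perfect = <⇒≱ r<∣S∣ (begin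
  ∣ S ∣   ≤⟨ ∣x∣≤wP P S ⟩
  wP P S  ≤⟨ perfect⇒cover∈Ball P perfect I′-ideal I″-ideal ⊆-refl ball⊆S ⟩
  r       ∎)
  where
  open ≤-Reasoning

  S : Subset n
  S = I′ ∪ I″

  r<∣S∣ : r < ∣ S ∣
  r<∣S∣ = ≢∧∣∣≡⇒<∣∪∣ (proj₂ I′-ideal) (proj₂ I″-ideal) I′≢I″

  ball⊆S : ∀ {b} → InBall P r b → b ⊆ S
  ball⊆S b∈Ball a∈b = Equivalence.to (Pr⇔I′∪I″ _) (inBall⊆Pr P r≤n b∈Ball a∈b)
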